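{- Let $\mathbb F_q$ be a finite field with $q$ elements, let $n\ge 2$, let $a_1,\dots,a_n\in\mathbb F_q^*$, and let $d_1,\dots,d_n$ be positive integers dividing $q-1$ (in the paper $d_j=\gcd(m_j,q-1)$ for positive integers $m_j$). If $d_1,\dots,d_n$ are pairwise coprime, then $$ N^*[a_1x_1^{d_1}+\dots+a_nx_n^{d_n}=0]=\frac{(q-1)^n+(-1)^n(q-1)}{q}. $$
   Context: $\mathbb F_q^*=\mathbb F_q\setminus\{0\}$. For polynomials $f_1,f_2$ over $\mathbb F_q$ in $n$ variables, $N^*[f_1(x_1,\dots,x_n)=f_2(x_1,\dots,x_n)]$ denotes the number of solutions $(x_1,\dots,x_n)\in\mathbb F_q^n$ of the equation with $x_1\cdots x_n\neq 0$. -}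

module Defs where

open import Level using (Level; _⊔_; suc)
open import Data.Nat using (ℕ; zero; suc)
open import Data.Fin using (Fin)
import Data.Fin as Fin
open import Data.List using (List; []; _∷_; [_]; map; concatMap; filter; length; allFin)
open import Data.Product using (Σ; _×_; _,_)
open import Data.Vec.Functional using (Vector)
import Data.Vec.Functional as V
open import Relation.Nullary using (¬_; Dec; yes; no)
open import Relation.Nullary.Decidable using (_×-dec_; ¬?)
open import Relation.Binary.PropositionalEquality using (_≡_)
open import Algebra.Bundles using (CommutativeRing; Semiring)
import Algebra.Definitions.RawSemiring as RS
import Algebra.Definitions.RawMonoid as RM

-- A finite field: a commutative ring (with setoid equality _≈_) that is
-- nontrivial, in which every nonzero element has a multiplicative inverse,
-- whose equality is decidable, and whose carrier is enumerated (up to ≈)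
-- bijectively by Fin size.  `size` is q.
record FiniteField (c ℓ : Level) : Set (Level.suc (c ⊔ ℓ)) where
  field
    commutativeRing : CommutativeRing c ℓ
  open CommutativeRing commutativeRing public
  field
    0≉1      : ¬ (0# ≈ 1#)
    inverse  : ∀ x → ¬ (x ≈ 0#) → Σ Carrier (λ y → (x * y) ≈ 1#)
    _≟_      : ∀ x y → Dec (x ≈ y)
    size     : ℕ
    enum     : Fin size → Carrier
    enum-injective  : ∀ i j → enum i ≈ enum j → i ≡ j
    enum-surjective : ∀ x → Σ (Fin size) (λ i → enum i ≈ x)

  open RS (Semiring.rawSemiring semiring) public using (_^_)
  open RM +-rawMonoid public using (sum)

tuples : (q n : ℕ) → List (Vector (Fin q) n)
tuples q zero    = [ (λ ()) ]
tuples q (suc n) = concatMap (λ i → map (λ f → i V.∷ f) (tuples q n)) (allFin q)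

module _ {c ℓ : Level} (F : FiniteField c ℓ) where
  open FiniteField F

  -- N*[ a₁ x₁^{d₁} + … + aₙ xₙ^{dₙ} = 0 ]: the number of (x₁,…,xₙ) ∈ F^n
  -- with all xⱼ ≠ 0 and Σⱼ aⱼ xⱼ^{dⱼ} = 0 (points of F^n are enumerated
  -- via enum, so each solution is counted exactly once).
  N*-diagonal : (n : ℕ) → Vector Carrier n → Vector ℕ n → ℕ
  N*-diagonal n a d = length (filter P? (tuples size n))
    where
      allNonzero? : (m : ℕ) → (x : Vector Carrier m) → Dec (∀ j → ¬ (x j ≈ 0#))
      allNonzero? zero x = yes (λ ())
      allNonzero? (suc m) x with ¬? (x Fin.zero ≟ 0#) | allNonzero? m (V.tail x)
      ... | yes p | yes q = yes (λ { Fin.zero → p ; (Fin.suc j) → q j })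
      ... | no p  | _     = no (λ h → p (h Fin.zero))
      ... | yes _ | no q  = no (λ h → q (λ j → h (Fin.suc j)))
      P? : (i : Vector (Fin size) n) → Dec ((∀ j → ¬ (enum (i j) ≈ 0#)) ×
                                            (sum (λ j → a j * (enum (i j) ^ d j)) ≈ 0#))
      P? i = allNonzero? n (λ j → enum (i j)) ×-dec (sum (λ j → a j * (enum (i j) ^ d j)) ≟ 0#)

{-# OPTIONS --safe #-}
-- Write N*ₙ(c) for the number of x ∈ (F*)ⁿ with a₁x₁^{d₁} + ⋯ + aₙxₙ^{dₙ} = c, and D = d₂⋯dₙ.
-- N*ₙ₋₁ is invariant under c ↦ c·t^D for t ≠ 0, and gcd(d₁, D) = 1 makes every nonzero z a
-- product s^{d₁} t^D (Bézout).  Counting Σ_{x,y≠0} G(x^{d₁} y^D) in two ways then gives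
-- Σ_{x≠0} G(x^{d₁}) = Σ_{x≠0} G(x) for every such invariant G, hence
--   N*ₙ(0) = Σ_{x≠0} N*ₙ₋₁(−a₁x^{d₁}) = Σ_{c≠0} N*ₙ₋₁(c) = (q−1)ⁿ⁻¹ − N*ₙ₋₁(0),
-- and induction on n yields q·N*ₙ(0) = (q−1)ⁿ + (−1)ⁿ(q−1).
module Submission where

open import Defs
open import Level using (Level; _⊔_)
open import Data.Fin using (Fin; zero; suc)
open import Data.Fin.Properties using (punchInᵢ≢i; all?; suc-injective)
open import Data.List using (List; []; _∷_; _++_; map; filter; length; concatMap; tabulate; allFin)
open import Data.List.Properties using (map-++; map-∘; map-tabulate; map-cong)
open import Data.Product using (_×_; _,_; ∃₂; proj₁; proj₂)
open import Data.Vec.Functional as V using (Vector; head; tail)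
open import Function using (_∘_; _⇔_; mk⇔; Equivalence; Congruent)
open import Relation.Nullary using (¬_; Dec; yes; no; ¬?; _×-dec_; contradiction)
open import Relation.Unary using (Decidable)
open import Relation.Binary.PropositionalEquality as ≡ using (_≡_; _≢_)
import Algebra.Properties.Semiring.Sum

module Counting where
  open import Data.Nat using (ℕ; zero; suc; _+_; _*_; _∸_; NonZero)
  import Data.Nat.Properties as ℕ
  import Data.Nat.ListAction as List
  open import Data.Nat.ListAction.Properties using (sum-++)
  open import Algebra.Properties.Semiring.Sum ℕ.+-*-semiring
    using (sum; sum-syntax; sum-remove; sum-cong-≗; sum-replicate-zero)
  open ≡ using (refl; sym; trans; cong; module ≡-Reasoning)
  open ≡-Reasoning

  private
    variable
      a p q : Level
      A B : Set a
      P : Set p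
      Q : Set q

  𝟙 : Dec P → ℕ
  𝟙 (yes _) = 1
  𝟙 (no _)  = 0

  𝟙-yes : P → (p? : Dec P) → 𝟙 p? ≡ 1
  𝟙-yes p (yes _) = refl
  𝟙-yes p (no ¬p) = contradiction p ¬p

  𝟙-no : ¬ P → (p? : Dec P) → 𝟙 p? ≡ 0
  𝟙-no ¬p (yes p) = contradiction p ¬p
  𝟙-no ¬p (no _)  = refl

  𝟙-cong : P ⇔ Q → (p? : Dec P) (q? : Dec Q) → 𝟙 p? ≡ 𝟙 q?
  𝟙-cong P⇔Q p? (yes q) = 𝟙-yes (Equivalence.from P⇔Q q) p?
  𝟙-cong P⇔Q p? (no ¬q) = 𝟙-no (¬q ∘ Equivalence.to P⇔Q) p?

  𝟙-× : (p? : Dec P) (q? : Dec Q) → 𝟙 (p? ×-dec q?) ≡ 𝟙 p? * 𝟙 q?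
  𝟙-× (yes _) (yes _) = refl
  𝟙-× (yes _) (no _)  = refl
  𝟙-× (no _)  _       = refl

  𝟙-¬ : (p? : Dec P) → 𝟙 (¬? p?) + 𝟙 p? ≡ 1
  𝟙-¬ (yes _) = refl
  𝟙-¬ (no _)  = refl

  length-filter : {P : A → Set p} (P? : Decidable P) (xs : List A) →
                  length (filter P? xs) ≡ List.sum (map (𝟙 ∘ P?) xs)
  length-filter P? []       = refl
  length-filter P? (x ∷ xs) with P? x
  ... | yes _ = cong suc (length-filter P? xs)
  ... | no  _ = length-filter P? xs

  sum-map-*ˡ : ∀ k (f : A → ℕ) xs → List.sum (map (λ x → k * f x) xs) ≡ k * List.sum (map f xs)
  sum-map-*ˡ k f []       = sym (ℕ.*-zeroʳ k)
  sum-map-*ˡ k f (x ∷ xs) = begin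
    k * f x + List.sum (map (λ x → k * f x) xs)  ≡⟨ cong (k * f x +_) (sum-map-*ˡ k f xs) ⟩
    k * f x + k * List.sum (map f xs)            ≡⟨ ℕ.*-distribˡ-+ k (f x) _ ⟨
    k * List.sum (map f (x ∷ xs))                ∎

  sum-map-concatMap : (f : B → ℕ) (g : A → List B) (xs : List A) →
    List.sum (map f (concatMap g xs)) ≡ List.sum (map (λ x → List.sum (map f (g x))) xs)
  sum-map-concatMap f g []       = refl
  sum-map-concatMap f g (x ∷ xs) = begin
    List.sum (map f (g x ++ concatMap g xs))
      ≡⟨ cong List.sum (map-++ f (g x) _) ⟩
    List.sum (map f (g x) ++ map f (concatMap g xs))
      ≡⟨ sum-++ (map f (g x)) _ ⟩
    List.sum (map f (g x)) + List.sum (map f (concatMap g xs))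
      ≡⟨ cong (List.sum (map f (g x)) +_) (sum-map-concatMap f g xs) ⟩
    List.sum (map (λ x → List.sum (map f (g x))) (x ∷ xs)) ∎

  sum-tabulate : ∀ {n} (f : Fin n → ℕ) → List.sum (tabulate f) ≡ ∑[ i < n ] f i
  sum-tabulate {zero}  f = refl
  sum-tabulate {suc n} f = cong (f zero +_) (sum-tabulate (f ∘ suc))

  sum-tuples-suc : ∀ q n (f : Vector (Fin q) (suc n) → ℕ) →
    List.sum (map f (tuples q (suc n))) ≡ ∑[ i < q ] List.sum (map (λ v → f (i V.∷ v)) (tuples q n))
  sum-tuples-suc q n f = begin
    List.sum (map f (concatMap (λ i → map (i V.∷_) (tuples q n)) (allFin q)))
      ≡⟨ sum-map-concatMap f _ (allFin q) ⟩
    List.sum (map row (allFin q))      ≡⟨ cong List.sum (map-tabulate (λ i → i) row) ⟩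
    List.sum (tabulate row)            ≡⟨ sum-tabulate row ⟩
    ∑[ i < q ] row i                   ≡⟨ sum-cong-≗ (λ i → cong List.sum (map-∘ {g = f} {f = i V.∷_} (tuples q n))) ⟨
    ∑[ i < q ] List.sum (map (λ v → f (i V.∷ v)) (tuples q n)) ∎
    where
    row : Fin q → ℕ
    row i = List.sum (map f (map (i V.∷_) (tuples q n)))

  sum-single : ∀ {m} (t : Vector ℕ m) (j : Fin m) → (∀ i → i ≢ j → t i ≡ 0) → sum t ≡ t j
  sum-single {suc m} t j t≡0 = begin
    sum t                           ≡⟨ sum-remove t ⟩
    t j + sum (V.removeAt t j)      ≡⟨ cong (t j +_) (sum-cong-≗ (λ k → t≡0 _ (punchInᵢ≢i j k))) ⟩
    t j + sum (V.replicate m 0)     ≡⟨ cong (t j +_) (sum-replicate-zero m) ⟩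
    t j + 0                         ≡⟨ ℕ.+-identityʳ (t j) ⟩
    t j                             ∎

  sum-const : ∀ m k → ∑[ i < m ] k ≡ m * k
  sum-const zero    k = refl
  sum-const (suc m) k = cong (k +_) (sum-const m k)

  Fin⇒suc-pred : ∀ {m} → Fin m → suc (m ∸ 1) ≡ m
  Fin⇒suc-pred {suc m} _ = refl

  distinct⇒pred-nonZero : ∀ {m} (i j : Fin m) → i ≢ j → NonZero (m ∸ 1)
  distinct⇒pred-nonZero {suc zero}    zero zero i≢j = contradiction refl i≢j
  distinct⇒pred-nonZero {suc (suc m)} _    _    _   = _

module FieldLemmas {c ℓ : Level} (F : FiniteField c ℓ) where
  open import Data.Nat as ℕ using (zero; suc)
  import Data.Nat.Properties as ℕ
  open import Data.Nat.Coprimality using (Coprime; coprime-Bézout)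
  open import Data.Nat.GCD using (module Bézout)
  open FiniteField F
  open import Algebra.Properties.Group +-group using (//-rightDividesˡ; //-rightDividesʳ; ⁻¹-involutive; ε⁻¹≈ε)
  open import Algebra.Properties.Ring ring using (-‿distribʳ-*; [y-z]x≈yx-zx)
  open import Algebra.Properties.Semiring.Exp semiring using (^-congʳ; ^-assocʳ)
  open import Algebra.Properties.CommutativeSemiring.Exp commutativeSemiring using (^-distrib-*)
  open import Algebra.Properties.CommutativeSemigroup *-commutativeSemigroup using (interchange)
  open import Relation.Binary.Reasoning.Setoid setoid

  private
    variable
      s t u v w x y z : Carrier

  x*w*u≈x : w * u ≈ 1# → ∀ x → x * w * u ≈ x
  x*w*u≈x {w} {u} wu≈1 x = begin
    x * w * u   ≈⟨ *-assoc x w u ⟩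
    x * (w * u) ≈⟨ *-congˡ wu≈1 ⟩
    x * 1#      ≈⟨ *-identityʳ x ⟩
    x           ∎

  x*w≈y⇔x≈y*u : w * u ≈ 1# → x * w ≈ y ⇔ x ≈ y * u
  x*w≈y⇔x≈y*u {w} {u} {x} {y} wu≈1 = mk⇔
    (λ xw≈y → trans (sym (x*w*u≈x wu≈1 x)) (*-congʳ xw≈y))
    (λ x≈yu → trans (*-congʳ x≈yu) (x*w*u≈x (trans (*-comm u w) wu≈1) y))

  *-cancelʳ : w ≉ 0# → u * w ≈ v * w → u ≈ v
  *-cancelʳ {w} {u} {v} w≉0 uw≈vw with inverse w w≉0
  ... | w⁻¹ , ww⁻¹≈1 = trans (Equivalence.to (x*w≈y⇔x≈y*u ww⁻¹≈1) uw≈vw) (x*w*u≈x ww⁻¹≈1 v)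

  x*y≈0⇔x≈0 : y ≉ 0# → x * y ≈ 0# ⇔ x ≈ 0#
  x*y≈0⇔x≈0 {y} {x} y≉0 = mk⇔
    (λ xy≈0 → *-cancelʳ y≉0 (trans xy≈0 (sym (zeroˡ y))))
    (λ x≈0 → trans (*-congʳ x≈0) (zeroˡ y))

  x*y≉0 : x ≉ 0# → y ≉ 0# → x * y ≉ 0#
  x*y≉0 x≉0 y≉0 = x≉0 ∘ Equivalence.to (x*y≈0⇔x≈0 y≉0)

  x^n≉0 : x ≉ 0# → ∀ n → x ^ n ≉ 0#
  x^n≉0 x≉0 zero    = 0≉1 ∘ sym
  x^n≉0 x≉0 (suc n) = x*y≉0 x≉0 (x^n≉0 x≉0 n)

  -x≉0 : x ≉ 0# → - x ≉ 0#
  -x≉0 {x} x≉0 -x≈0 = x≉0 (begin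
    x       ≈⟨ ⁻¹-involutive x ⟨
    - (- x) ≈⟨ -‿cong -x≈0 ⟩
    - 0#    ≈⟨ ε⁻¹≈ε ⟩
    0#      ∎)

  x+y≈z⇔x≈z-y : x + y ≈ z ⇔ x ≈ z - y
  x+y≈z⇔x≈z-y {x} {y} {z} = mk⇔
    (λ x+y≈z → trans (sym (//-rightDividesʳ y x)) (+-congʳ x+y≈z))
    (λ x≈z-y → trans (+-congʳ x≈z-y) (//-rightDividesˡ y z))

  x+y≈z⇔y≈z-x : x + y ≈ z ⇔ y ≈ z - x
  x+y≈z⇔y≈z-x {x} {y} = mk⇔
    (Equivalence.to x+y≈z⇔x≈z-y ∘ trans (+-comm y x))
    (trans (+-comm x y) ∘ Equivalence.from x+y≈z⇔x≈z-y)

  w^[1+m]*u^m≈w : w * u ≈ 1# → ∀ m → w ^ suc m * u ^ m ≈ w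
  w^[1+m]*u^m≈w {w} {u} wu≈1 zero = trans (*-identityʳ (w * 1#)) (*-identityʳ w)
  w^[1+m]*u^m≈w {w} {u} wu≈1 (suc m) = begin
    w * w ^ suc m * (u * u ^ m)   ≈⟨ interchange w (w ^ suc m) u (u ^ m) ⟩
    w * u * (w ^ suc m * u ^ m)   ≈⟨ *-cong wu≈1 (w^[1+m]*u^m≈w wu≈1 m) ⟩
    1# * w                        ≈⟨ *-identityˡ w ⟩
    w                             ∎

  inverse≉0 : w * u ≈ 1# → u ≉ 0#
  inverse≉0 {w} wu≈1 u≈0 = 0≉1 (trans (sym (trans (*-congˡ u≈0) (zeroʳ w))) wu≈1)

  power-decomposition : ∀ {e D} → Coprime e D → w ≉ 0# →
                        ∃₂ λ s t → s ≉ 0# × t ≉ 0# × s ^ e * t ^ D ≈ w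
  power-decomposition {w} {e} {D} e⊥D w≉0 with inverse w w≉0 | coprime-Bézout e⊥D
  ... | u , wu≈1 | Bézout.+- i j 1+jD≡ie =
    w ^ i , u ^ j , x^n≉0 w≉0 i , x^n≉0 (inverse≉0 wu≈1) j , (begin
      (w ^ i) ^ e * (u ^ j) ^ D          ≈⟨ *-cong (^-assocʳ w i e) (^-assocʳ u j D) ⟩
      w ^ (i ℕ.* e) * u ^ (j ℕ.* D)      ≈⟨ *-congʳ (^-congʳ w (≡.sym 1+jD≡ie)) ⟩
      w ^ suc (j ℕ.* D) * u ^ (j ℕ.* D)  ≈⟨ w^[1+m]*u^m≈w wu≈1 (j ℕ.* D) ⟩
      w                                  ∎)
  ... | u , wu≈1 | Bézout.-+ i j 1+ie≡jD =
    u ^ i , w ^ j , x^n≉0 (inverse≉0 wu≈1) i , x^n≉0 w≉0 j , (begin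
      (u ^ i) ^ e * (w ^ j) ^ D          ≈⟨ *-cong (^-assocʳ u i e) (^-assocʳ w j D) ⟩
      u ^ (i ℕ.* e) * w ^ (j ℕ.* D)      ≈⟨ *-congˡ (^-congʳ w (≡.sym 1+ie≡jD)) ⟩
      u ^ (i ℕ.* e) * w ^ suc (i ℕ.* e)  ≈⟨ *-comm _ _ ⟩
      w ^ suc (i ℕ.* e) * u ^ (i ℕ.* e)  ≈⟨ w^[1+m]*u^m≈w wu≈1 (i ℕ.* e) ⟩
      w                                  ∎)

  rescaling-fibre : ∀ e D → z ≉ 0# → s ^ e * t ^ D ≈ z →
                    ∀ x y → z ≈ (x * s) ^ e * (y * t) ^ D ⇔ 1# ≈ x ^ e * y ^ D
  rescaling-fibre {z} {s} {t} e D z≉0 sᵉtᴰ≈z x y = mk⇔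
    (λ z≈ → *-cancelʳ z≉0 (trans (*-identityˡ z) (trans z≈ rescaled)))
    (λ 1≈ → trans (sym (*-identityˡ z)) (trans (*-congʳ 1≈) (sym rescaled)))
    where
    rescaled : (x * s) ^ e * (y * t) ^ D ≈ x ^ e * y ^ D * z
    rescaled = begin
      (x * s) ^ e * (y * t) ^ D            ≈⟨ *-cong (^-distrib-* x s e) (^-distrib-* y t D) ⟩
      x ^ e * s ^ e * (y ^ D * t ^ D)      ≈⟨ interchange (x ^ e) (s ^ e) (y ^ D) (t ^ D) ⟩
      x ^ e * y ^ D * (s ^ e * t ^ D)      ≈⟨ *-congˡ sᵉtᴰ≈z ⟩
      x ^ e * y ^ D * z                    ∎

  rescaled-difference : ∀ c a x t e P →
    c * t ^ (e ℕ.* P) - a * (x * t ^ P) ^ e ≈ (c - a * x ^ e) * (t ^ e) ^ P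
  rescaled-difference c a x t e P = begin
    c * τ - a * (x * t ^ P) ^ e   ≈⟨ +-congˡ (-‿cong (*-congˡ xtᴾ≈)) ⟩
    c * τ - a * (x ^ e * τ)       ≈⟨ +-congˡ (-‿cong (sym (*-assoc a (x ^ e) τ))) ⟩
    c * τ - a * x ^ e * τ         ≈⟨ [y-z]x≈yx-zx τ c (a * x ^ e) ⟨
    (c - a * x ^ e) * τ           ≈⟨ *-congˡ (^-assocʳ t e P) ⟨
    (c - a * x ^ e) * (t ^ e) ^ P ∎
    where
    τ = t ^ (e ℕ.* P)
    xtᴾ≈ : (x * t ^ P) ^ e ≈ x ^ e * τ
    xtᴾ≈ = trans (^-distrib-* x (t ^ P) e)
             (*-congˡ (trans (^-assocʳ t P e) (^-congʳ t (ℕ.*-comm P e))))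

  0-a*x≈x*-a : ∀ a x → 0# - a * x ≈ x * - a
  0-a*x≈x*-a a x = begin
    0# - a * x  ≈⟨ +-identityˡ (- (a * x)) ⟩
    - (a * x)   ≈⟨ -‿cong (*-comm a x) ⟩
    - (x * a)   ≈⟨ -‿distribʳ-* x a ⟩
    x * - a     ∎

module FieldSums {c ℓ : Level} (F : FiniteField c ℓ) where
  open import Data.Nat using (ℕ; suc; _+_; _*_; _∸_; NonZero)
  import Data.Nat.Properties as ℕ
  open import Algebra.Properties.CommutativeSemigroup ℕ.*-commutativeSemigroup using (x∙yz≈y∙xz)
  open import Data.Nat.Coprimality using (Coprime)
  private
    module Fin∑ = Algebra.Properties.Semiring.Sum ℕ.+-*-semiring
    module 𝔽 = FiniteField F
  open FiniteField F
    using (Carrier; _≈_; _≉_; 0#; 1#; _≟_; _^_; size; enum; enum-injective; enum-surjective; inverse; 0≉1)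
    renaming (_+_ to _⊕_; _*_ to _⊗_)
  open FieldLemmas F
  open import Algebra.Properties.Semiring.Exp 𝔽.semiring using (^-congˡ)
  open Counting
  open ≡ using (refl; sym; trans; cong; cong₂; module ≡-Reasoning)
  open ≡-Reasoning

  private
    variable
      G H : Carrier → ℕ
      s : Carrier

  [_≈_] : Carrier → Carrier → ℕ
  [ x ≈ y ] = 𝟙 (x ≟ y)

  [_≉0] : Carrier → ℕ
  [ x ≉0] = 𝟙 (¬? (x ≟ 0#))

  [≈]-cong : ∀ {x x′ y y′} → x ≈ x′ → y ≈ y′ → [ x ≈ y ] ≡ [ x′ ≈ y′ ]
  [≈]-cong x≈x′ y≈y′ = 𝟙-cong (mk⇔ (λ x≈y → 𝔽.trans (𝔽.sym x≈x′) (𝔽.trans x≈y y≈y′))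
                                   (λ x′≈y′ → 𝔽.trans x≈x′ (𝔽.trans x′≈y′ (𝔽.sym y≈y′)))) _ _

  [≉0]-cong : ∀ {x y} → x ≈ y → [ x ≉0] ≡ [ y ≉0]
  [≉0]-cong x≈y = 𝟙-cong (mk⇔ (λ x≉0 → x≉0 ∘ 𝔽.trans x≈y) (λ y≉0 → y≉0 ∘ 𝔽.trans (𝔽.sym x≈y))) _ _

  [≉0]-* : s ≉ 0# → ∀ x → [ x ⊗ s ≉0] ≡ [ x ≉0]
  [≉0]-* s≉0 x = 𝟙-cong (mk⇔ (λ xs≉0 → xs≉0 ∘ Equivalence.from (x*y≈0⇔x≈0 s≉0))
                             (λ x≉0 → x≉0 ∘ Equivalence.to (x*y≈0⇔x≈0 s≉0))) _ _

  -- Opaque, so that Agda reads off the summand G from a goal ∑ G ≡ ….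
  opaque
    ∑ : (Carrier → ℕ) → ℕ
    ∑ G = Fin∑.sum (G ∘ enum)

    ∑-enum : ∀ G → ∑ G ≡ Fin∑.sum (G ∘ enum)
    ∑-enum G = refl

    ∑-const : ∀ k → ∑ (λ _ → k) ≡ size * k
    ∑-const = sum-const size

    ∑-cong : (∀ x → G x ≡ H x) → ∑ G ≡ ∑ H
    ∑-cong G≗H = Fin∑.sum-cong-≗ (G≗H ∘ enum)

    ∑-comm : (f : Carrier → Carrier → ℕ) → ∑ (λ x → ∑ (f x)) ≡ ∑ (λ y → ∑ (λ x → f x y))
    ∑-comm f = Fin∑.∑-comm (λ i j → f (enum i) (enum j))

    ∑-+ : ∀ G H → ∑ (λ x → G x + H x) ≡ ∑ G + ∑ H
    ∑-+ G H = Fin∑.∑-distrib-+ (G ∘ enum) (H ∘ enum)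

    ∑-*ˡ : ∀ k G → ∑ (λ x → k * G x) ≡ k * ∑ G
    ∑-*ˡ k G = sym (Fin∑.*-distribˡ-sum k (G ∘ enum))

    ∑-*ʳ : ∀ G k → ∑ (λ x → G x * k) ≡ ∑ G * k
    ∑-*ʳ G k = sym (Fin∑.*-distribʳ-sum k (G ∘ enum))

    ∑-δ : Congruent _≈_ _≡_ G → ∀ z → ∑ (λ x → [ x ≈ z ] * G x) ≡ G z
    ∑-δ {G} G-cong z with enum-surjective z
    ... | i , enumᵢ≈z = begin
      Fin∑.sum (λ j → [ enum j ≈ z ] * G (enum j))  ≡⟨ sum-single _ i off-diagonal ⟩
      [ enum i ≈ z ] * G (enum i)                   ≡⟨ cong₂ _*_ (𝟙-yes enumᵢ≈z (enum i ≟ z)) (G-cong enumᵢ≈z) ⟩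
      G z + 0                                        ≡⟨ ℕ.+-identityʳ (G z) ⟩
      G z                                            ∎
      where
      off-diagonal : ∀ j → j ≢ i → [ enum j ≈ z ] * G (enum j) ≡ 0
      off-diagonal j j≢i = cong (_* G (enum j))
        (𝟙-no (λ enumⱼ≈z → j≢i (enum-injective j i (𝔽.trans enumⱼ≈z (𝔽.sym enumᵢ≈z)))) (enum j ≟ z))

  ∑* : (Carrier → ℕ) → ℕ
  ∑* G = ∑ (λ x → [ x ≉0] * G x)

  ∑-reindex : ∀ {f g : Carrier → Carrier} → Congruent _≈_ _≡_ G →
              (∀ {x y} → f x ≈ y ⇔ x ≈ g y) → ∑ (λ x → G (f x)) ≡ ∑ G
  ∑-reindex {G} {f} {g} G-cong f⇔g = begin
    ∑ (λ x → G (f x))                       ≡⟨ ∑-cong (λ x → sym (∑-δ G-cong (f x))) ⟩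
    ∑ (λ x → ∑ (λ y → [ y ≈ f x ] * G y))   ≡⟨ ∑-comm _ ⟩
    ∑ (λ y → ∑ (λ x → [ y ≈ f x ] * G y))   ≡⟨ ∑-cong (λ y → ∑-*ʳ _ (G y)) ⟩
    ∑ (λ y → ∑ (λ x → [ y ≈ f x ]) * G y)   ≡⟨ ∑-cong (λ y → cong (_* G y) (fibre y)) ⟩
    ∑ (λ y → G y + 0)                       ≡⟨ ∑-cong (λ y → ℕ.+-identityʳ (G y)) ⟩
    ∑ G                                     ∎
    where
    fibre : ∀ y → ∑ (λ x → [ y ≈ f x ]) ≡ 1
    fibre y = begin
      ∑ (λ x → [ y ≈ f x ])      ≡⟨ ∑-cong (λ x → 𝟙-cong (mk⇔ (Equivalence.to f⇔g ∘ 𝔽.sym)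
                                                               (𝔽.sym ∘ Equivalence.from f⇔g)) _ _) ⟩
      ∑ (λ x → [ x ≈ g y ])      ≡⟨ ∑-cong (λ x → sym (ℕ.*-identityʳ _)) ⟩
      ∑ (λ x → [ x ≈ g y ] * 1)  ≡⟨ ∑-δ (λ _ → refl) (g y) ⟩
      1                          ∎

  ∑-translate : Congruent _≈_ _≡_ G → ∀ t → ∑ (λ x → G (x ⊕ t)) ≡ ∑ G
  ∑-translate G-cong t = ∑-reindex G-cong x+y≈z⇔x≈z-y

  ∑-split : Congruent _≈_ _≡_ G → ∑ G ≡ ∑* G + G 0#
  ∑-split {G} G-cong = begin
    ∑ G                                          ≡⟨ ∑-cong (λ x → sym (ℕ.+-identityʳ (G x))) ⟩
    ∑ (λ x → 1 * G x)                            ≡⟨ ∑-cong (λ x → cong (_* G x) (sym (𝟙-¬ (x ≟ 0#)))) ⟩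
    ∑ (λ x → ([ x ≉0] + [ x ≈ 0# ]) * G x)       ≡⟨ ∑-cong (λ x → ℕ.*-distribʳ-+ (G x) [ x ≉0] _) ⟩
    ∑ (λ x → [ x ≉0] * G x + [ x ≈ 0# ] * G x)   ≡⟨ ∑-+ _ _ ⟩
    ∑* G + ∑ (λ x → [ x ≈ 0# ] * G x)            ≡⟨ cong (∑* G +_) (∑-δ G-cong 0#) ⟩
    ∑* G + G 0#                                  ∎

  ∑*-cong : (∀ x → x ≉ 0# → G x ≡ H x) → ∑* G ≡ ∑* H
  ∑*-cong {G} {H} G≈H = ∑-cong term
    where
    term : ∀ x → [ x ≉0] * G x ≡ [ x ≉0] * H x
    term x with x ≟ 0#
    ... | yes _   = refl
    ... | no x≉0 = cong (_+ 0) (G≈H x x≉0)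

  ∑*-*ˡ : ∀ k G → ∑* (λ x → k * G x) ≡ k * ∑* G
  ∑*-*ˡ k G = trans (∑-cong (λ x → x∙yz≈y∙xz [ x ≉0] k (G x))) (∑-*ˡ k _)

  ∑*-*ʳ : ∀ G k → ∑* (λ x → G x * k) ≡ ∑* G * k
  ∑*-*ʳ G k = trans (∑-cong (λ x → sym (ℕ.*-assoc [ x ≉0] (G x) k))) (∑-*ʳ _ k)

  ∑*-∑-comm : (f : Carrier → Carrier → ℕ) → ∑* (λ x → ∑ (f x)) ≡ ∑ (λ y → ∑* (λ x → f x y))
  ∑*-∑-comm f = trans (∑-cong (λ x → sym (∑-*ˡ [ x ≉0] (f x)))) (∑-comm _)

  ∑*-1 : ∑* (λ _ → 1) ≡ size ∸ 1
  ∑*-1 = begin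
    ∑* (λ _ → 1)             ≡⟨ ℕ.m+n∸n≡m _ 1 ⟨
    ∑* (λ _ → 1) + 1 ∸ 1     ≡⟨ cong (_∸ 1) (∑-split {G = λ _ → 1} (λ _ → refl)) ⟨
    ∑ (λ _ → 1) ∸ 1          ≡⟨ cong (_∸ 1) (trans (∑-const 1) (ℕ.*-identityʳ size)) ⟩
    size ∸ 1                 ∎

  ∑*-const : ∀ k → ∑* (λ _ → k) ≡ (size ∸ 1) * k
  ∑*-const k = begin
    ∑ (λ x → [ x ≉0] * k)        ≡⟨ ∑-cong (λ x → cong (_* k) (ℕ.*-identityʳ [ x ≉0])) ⟨
    ∑ (λ x → [ x ≉0] * 1 * k)    ≡⟨ ∑-*ʳ _ k ⟩
    ∑* (λ _ → 1) * k             ≡⟨ cong (_* k) ∑*-1 ⟩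
    (size ∸ 1) * k               ∎

  ∑*-scale : Congruent _≈_ _≡_ G → s ≉ 0# → ∑* (λ x → G (x ⊗ s)) ≡ ∑* G
  ∑*-scale {G} {s} G-cong s≉0 with inverse s s≉0
  ... | s⁻¹ , ss⁻¹≈1 = begin
    ∑ (λ x → [ x ≉0] * G (x ⊗ s))       ≡⟨ ∑-cong (λ x → cong (_* G (x ⊗ s)) ([≉0]-* s≉0 x)) ⟨
    ∑ (λ x → [ x ⊗ s ≉0] * G (x ⊗ s))   ≡⟨ ∑-reindex H-cong (x*w≈y⇔x≈y*u ss⁻¹≈1) ⟩
    ∑* G                                ∎
    where
    H-cong : Congruent _≈_ _≡_ (λ y → [ y ≉0] * G y)
    H-cong y≈y′ = cong₂ _*_ ([≉0]-cong y≈y′) (G-cong y≈y′)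

  size∸1-nonZero : NonZero (size ∸ 1)
  size∸1-nonZero with enum-surjective 0# | enum-surjective 1#
  ... | i , enumᵢ≈0 | j , enumⱼ≈1 = distinct⇒pred-nonZero i j i≢j
    where
    i≢j : i ≢ j
    i≢j i≡j = 0≉1 (𝔽.trans (𝔽.sym enumᵢ≈0) (𝔽.trans (𝔽.reflexive (cong enum i≡j)) enumⱼ≈1))

  suc[size∸1]≡size : suc (size ∸ 1) ≡ size
  suc[size∸1]≡size = Fin⇒suc-pred (proj₁ (enum-surjective 0#))

  ∑*-zero : ∑* (λ _ → 0) ≡ 0
  ∑*-zero = trans (∑*-const 0) (ℕ.*-zeroʳ (size ∸ 1))

  PowerInvariant : ℕ → (Carrier → ℕ) → Set (c ⊔ ℓ)
  PowerInvariant D G = ∀ x {t} → t ≉ 0# → G (x ⊗ t ^ D) ≡ G x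

  module _ (e D : ℕ) where

    doubleSum : (Carrier → ℕ) → ℕ
    doubleSum G = ∑* (λ x → ∑* (λ y → G (x ^ e ⊗ y ^ D)))

    fibre : Carrier → ℕ
    fibre z = ∑* (λ x → ∑* (λ y → [ z ≈ x ^ e ⊗ y ^ D ]))

    doubleSum-invariant : PowerInvariant D G → doubleSum G ≡ (size ∸ 1) * ∑* (λ x → G (x ^ e))
    doubleSum-invariant {G} G-inv = begin
      ∑* (λ x → ∑* (λ y → G (x ^ e ⊗ y ^ D)))  ≡⟨ ∑*-cong (λ x _ → ∑*-cong (λ y → G-inv (x ^ e))) ⟩
      ∑* (λ x → ∑* (λ _ → G (x ^ e)))          ≡⟨ ∑*-cong (λ x _ → ∑*-const (G (x ^ e))) ⟩
      ∑* (λ x → (size ∸ 1) * G (x ^ e))        ≡⟨ ∑*-*ˡ (size ∸ 1) (λ x → G (x ^ e)) ⟩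
      (size ∸ 1) * ∑* (λ x → G (x ^ e))        ∎

    doubleSum-pushforward : Congruent _≈_ _≡_ G → doubleSum G ≡ ∑ (λ z → fibre z * G z)
    doubleSum-pushforward {G} G-cong = begin
      ∑* (λ x → ∑* (λ y → G (φ x y)))
        ≡⟨ ∑*-cong (λ x _ → ∑*-cong (λ y _ → sym (∑-δ G-cong (φ x y)))) ⟩
      ∑* (λ x → ∑* (λ y → ∑ (λ z → [ z ≈ φ x y ] * G z)))
        ≡⟨ ∑*-cong (λ x _ → ∑*-∑-comm (λ y z → [ z ≈ φ x y ] * G z)) ⟩
      ∑* (λ x → ∑ (λ z → ∑* (λ y → [ z ≈ φ x y ] * G z)))
        ≡⟨ ∑*-∑-comm (λ x z → ∑* (λ y → [ z ≈ φ x y ] * G z)) ⟩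
      ∑ (λ z → ∑* (λ x → ∑* (λ y → [ z ≈ φ x y ] * G z)))
        ≡⟨ ∑-cong (λ z → trans (∑*-cong (λ x _ → ∑*-*ʳ (λ y → [ z ≈ φ x y ]) (G z)))
                                (∑*-*ʳ (λ x → ∑* (λ y → [ z ≈ φ x y ])) (G z))) ⟩
      ∑ (λ z → fibre z * G z)
        ∎
      where
      φ : Carrier → Carrier → Carrier
      φ x y = x ^ e ⊗ y ^ D

    -- Bézout writes z = s^e t^D; rescaling x by s and y by t carries the fibre over 1 onto it.
    fibre-uniform : Coprime e D → ∀ z → fibre z ≡ [ z ≉0] * fibre 1#
    fibre-uniform e⊥D z with z ≟ 0#
    ... | yes z≈0 = trans (∑*-cong (λ x x≉0 → trans (∑*-cong (λ y y≉0 → off-support x≉0 y≉0)) ∑*-zero))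
                          ∑*-zero
      where
      off-support : ∀ {x y} → x ≉ 0# → y ≉ 0# → [ z ≈ x ^ e ⊗ y ^ D ] ≡ 0
      off-support {x} {y} x≉0 y≉0 =
        𝟙-no (λ z≈ → x*y≉0 (x^n≉0 x≉0 e) (x^n≉0 y≉0 D) (𝔽.trans (𝔽.sym z≈) z≈0)) (z ≟ (x ^ e ⊗ y ^ D))
    ... | no z≉0 with power-decomposition e⊥D z≉0
    ... | s , t , s≉0 , t≉0 , sᵉtᴰ≈z = begin
      ∑* (λ x → ∑* (λ y → [ z ≈ x ^ e ⊗ y ^ D ]))
        ≡⟨ ∑*-scale outer-cong s≉0 ⟨
      ∑* (λ x → ∑* (λ y → [ z ≈ (x ⊗ s) ^ e ⊗ y ^ D ]))
        ≡⟨ ∑*-cong (λ x _ → ∑*-scale (inner-cong x) t≉0) ⟨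
      ∑* (λ x → ∑* (λ y → [ z ≈ (x ⊗ s) ^ e ⊗ (y ⊗ t) ^ D ]))
        ≡⟨ ∑*-cong (λ x _ → ∑*-cong (λ y _ → 𝟙-cong (rescaling-fibre e D z≉0 sᵉtᴰ≈z x y) _ _)) ⟩
      fibre 1#
        ≡⟨ ℕ.+-identityʳ (fibre 1#) ⟨
      fibre 1# + 0
        ∎
      where
      outer-cong : Congruent _≈_ _≡_ (λ x → ∑* (λ y → [ z ≈ x ^ e ⊗ y ^ D ]))
      outer-cong x≈x′ = ∑*-cong (λ y _ → [≈]-cong 𝔽.refl (𝔽.*-congʳ (^-congˡ e x≈x′)))
      inner-cong : ∀ x → Congruent _≈_ _≡_ (λ y → [ z ≈ (x ⊗ s) ^ e ⊗ y ^ D ])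
      inner-cong x y≈y′ = [≈]-cong 𝔽.refl (𝔽.*-congˡ (^-congˡ D y≈y′))

    doubleSum-fibres : Coprime e D → Congruent _≈_ _≡_ G → doubleSum G ≡ fibre 1# * ∑* G
    doubleSum-fibres {G} e⊥D G-cong = begin
      doubleSum G                               ≡⟨ doubleSum-pushforward G-cong ⟩
      ∑ (λ z → fibre z * G z)                   ≡⟨ ∑-cong (λ z → cong (_* G z) (fibre-uniform e⊥D z)) ⟩
      ∑ (λ z → [ z ≉0] * fibre 1# * G z)        ≡⟨ ∑-cong (λ z → trans (ℕ.*-assoc [ z ≉0] (fibre 1#) (G z))
                                                                      (x∙yz≈y∙xz [ z ≉0] (fibre 1#) (G z))) ⟩
      ∑ (λ z → fibre 1# * ([ z ≉0] * G z))      ≡⟨ ∑-*ˡ (fibre 1#) (λ z → [ z ≉0] * G z) ⟩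
      fibre 1# * ∑* G                           ∎

    fibre-1≡size∸1 : Coprime e D → fibre 1# ≡ size ∸ 1
    fibre-1≡size∸1 e⊥D = ℕ.*-cancelʳ-≡ (fibre 1#) (size ∸ 1) (size ∸ 1) {{size∸1-nonZero}} (begin
      fibre 1# * (size ∸ 1)          ≡⟨ cong (fibre 1# *_) ∑*-1 ⟨
      fibre 1# * ∑* (λ _ → 1)        ≡⟨ doubleSum-fibres {λ _ → 1} e⊥D (λ _ → refl) ⟨
      doubleSum (λ _ → 1)            ≡⟨ doubleSum-invariant (λ _ _ → refl) ⟩
      (size ∸ 1) * ∑* (λ _ → 1)      ≡⟨ cong ((size ∸ 1) *_) ∑*-1 ⟩
      (size ∸ 1) * (size ∸ 1)        ∎)

    ∑*-power : Coprime e D → Congruent _≈_ _≡_ G → PowerInvariant D G →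
               ∑* (λ x → G (x ^ e)) ≡ ∑* G
    ∑*-power {G} e⊥D G-cong G-inv = ℕ.*-cancelˡ-≡ _ _ (size ∸ 1) {{size∸1-nonZero}} (begin
      (size ∸ 1) * ∑* (λ x → G (x ^ e))  ≡⟨ doubleSum-invariant G-inv ⟨
      doubleSum G                        ≡⟨ doubleSum-fibres e⊥D G-cong ⟩
      fibre 1# * ∑* G                    ≡⟨ cong (_* ∑* G) (fibre-1≡size∸1 e⊥D) ⟩
      (size ∸ 1) * ∑* G                  ∎)

module Arithmetic where
  open import Data.Nat using (ℕ; _*_)
  open import Data.Nat.Divisibility using (∣-trans; ∣1⇒≡1)
  open import Data.Nat.Coprimality using (Coprime; coprime-divisor)

  ∏ : ∀ {n} → Vector ℕ n → ℕ
  ∏ = V.foldr _*_ 1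

  coprime-* : ∀ {m n o} → Coprime m n → Coprime m o → Coprime m (n * o)
  coprime-* {m} {n} {o} m⊥n m⊥o {k} (k∣m , k∣no) = m⊥o (k∣m , coprime-divisor k⊥n k∣no)
    where
    k⊥n : Coprime k n
    k⊥n (i∣k , i∣n) = m⊥n (∣-trans i∣k k∣m , i∣n)

  coprime-∏ : ∀ {m n} (d : Vector ℕ n) → (∀ j → Coprime m (d j)) → Coprime m (∏ d)
  coprime-∏ {n = ℕ.zero}  d m⊥d (_ , k∣1) = ∣1⇒≡1 k∣1
  coprime-∏ {n = ℕ.suc n} d m⊥d = coprime-* (m⊥d zero) (coprime-∏ (tail d) (m⊥d ∘ suc))

module DiagonalEquation {c ℓ : Level} (F : FiniteField c ℓ) where
  open import Data.Nat using (ℕ; zero; suc; _+_; _*_; _∸_)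
  import Data.Nat as ℕ
  import Data.Nat.Properties as ℕ
  import Data.Nat.ListAction as List
  open import Data.Nat.Coprimality using (Coprime)
  open FiniteField F
    using (Carrier; _≈_; _≉_; 0#; _≟_; _^_; size; enum; sum)
    renaming (_*_ to _⊗_; _-_ to _⊖_; -_ to ⊖_)
  private
    module 𝔽 = FiniteField F
    module Fin∑ = Algebra.Properties.Semiring.Sum ℕ.+-*-semiring
  open import Algebra.Properties.Semiring.Exp 𝔽.semiring using (^-congˡ)
  open FieldLemmas F
  open FieldSums F
  open Counting
  open Arithmetic
  open import Algebra.Properties.CommutativeSemigroup 𝔽.*-commutativeSemigroup using (xy∙z≈xz∙y)
  open ≡ using (refl; sym; trans; cong; module ≡-Reasoning)
  open ≡-Reasoning
  open Fin∑ using (sum-syntax)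

  N* : (n : ℕ) → Vector Carrier n → Vector ℕ n → Carrier → ℕ
  N* zero    a d c = [ c ≈ 0# ]
  N* (suc n) a d c = ∑* (λ x → N* n (tail a) (tail d) (c ⊖ head a ⊗ x ^ head d))

  N*-cong : ∀ n a d → Congruent _≈_ _≡_ (N* n a d)
  N*-cong zero    a d c≈c′ = [≈]-cong c≈c′ 𝔽.refl
  N*-cong (suc n) a d c≈c′ = ∑*-cong (λ x _ → N*-cong n (tail a) (tail d) (𝔽.+-congʳ c≈c′))

  ∑-N* : ∀ n a d → ∑ (N* n a d) ≡ (size ∸ 1) ℕ.^ n
  ∑-N* zero    a d = trans (∑-cong (λ x → sym (ℕ.*-identityʳ [ x ≈ 0# ]))) (∑-δ (λ _ → refl) 0#)
  ∑-N* (suc n) a d = begin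
    ∑ (λ c → ∑* (λ x → N′ (c ⊖ a₀ ⊗ x ^ e)))
      ≡⟨ ∑*-∑-comm (λ x c → N′ (c ⊖ a₀ ⊗ x ^ e)) ⟨
    ∑* (λ x → ∑ (λ c → N′ (c ⊖ a₀ ⊗ x ^ e)))
      ≡⟨ ∑*-cong (λ x _ → ∑-translate (N*-cong n a′ d′) (⊖ (a₀ ⊗ x ^ e))) ⟩
    ∑* (λ _ → ∑ N′)
      ≡⟨ ∑*-const (∑ N′) ⟩
    (size ∸ 1) * ∑ N′
      ≡⟨ cong ((size ∸ 1) *_) (∑-N* n a′ d′) ⟩
    (size ∸ 1) * (size ∸ 1) ℕ.^ n
      ∎
    where
    a₀ = head a
    e = head d
    a′ = tail a
    d′ = tail d
    N′ = N* n a′ d′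

  N*-invariant : ∀ n a d → PowerInvariant (∏ d) (N* n a d)
  N*-invariant zero    a d c t≉0 = 𝟙-cong (x*y≈0⇔x≈0 (x^n≉0 t≉0 1)) _ _
  N*-invariant (suc n) a d c {t} t≉0 = begin
    ∑* (λ x → N′ (c ⊗ t ^ (e * P) ⊖ a₀ ⊗ x ^ e))
      ≡⟨ ∑*-scale term-cong (x^n≉0 t≉0 P) ⟨
    ∑* (λ x → N′ (c ⊗ t ^ (e * P) ⊖ a₀ ⊗ (x ⊗ t ^ P) ^ e))
      ≡⟨ ∑*-cong (λ x _ → N*-cong n a′ d′ (rescaled-difference c a₀ x t e P)) ⟩
    ∑* (λ x → N′ ((c ⊖ a₀ ⊗ x ^ e) ⊗ (t ^ e) ^ P))
      ≡⟨ ∑*-cong (λ x _ → N*-invariant n a′ d′ (c ⊖ a₀ ⊗ x ^ e) (x^n≉0 t≉0 e)) ⟩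
    ∑* (λ x → N′ (c ⊖ a₀ ⊗ x ^ e))
      ∎
    where
    a₀ = head a
    e = head d
    a′ = tail a
    d′ = tail d
    P = ∏ d′
    N′ = N* n a′ d′
    term-cong : Congruent _≈_ _≡_ (λ x → N′ (c ⊗ t ^ (e * P) ⊖ a₀ ⊗ x ^ e))
    term-cong x≈x′ = N*-cong n a′ d′ (𝔽.+-congˡ (𝔽.-‿cong (𝔽.*-congˡ (^-congˡ e x≈x′))))

  N*-recurrence : ∀ n a d → head a ≉ 0# → Coprime (head d) (∏ (tail d)) →
                  N* (suc n) a d 0# + N* n (tail a) (tail d) 0# ≡ (size ∸ 1) ℕ.^ n
  N*-recurrence n a d a₀≉0 e⊥P = begin
    N* (suc n) a d 0# + N′ 0#  ≡⟨ cong (_+ N′ 0#) ∑*-N*-reduction ⟩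
    ∑* N′ + N′ 0#              ≡⟨ ∑-split (N*-cong n a′ d′) ⟨
    ∑ N′                       ≡⟨ ∑-N* n a′ d′ ⟩
    (size ∸ 1) ℕ.^ n           ∎
    where
    a₀ = head a
    e = head d
    a′ = tail a
    d′ = tail d
    N′ = N* n a′ d′
    G : Carrier → ℕ
    G y = N′ (y ⊗ ⊖ a₀)
    G-cong : Congruent _≈_ _≡_ G
    G-cong y≈y′ = N*-cong n a′ d′ (𝔽.*-congʳ y≈y′)
    G-invariant : PowerInvariant (∏ d′) G
    G-invariant y t≉0 = trans (N*-cong n a′ d′ (xy∙z≈xz∙y y _ (⊖ a₀)))
                              (N*-invariant n a′ d′ (y ⊗ ⊖ a₀) t≉0)
    ∑*-N*-reduction : ∑* (λ x → N′ (0# ⊖ a₀ ⊗ x ^ e)) ≡ ∑* N′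
    ∑*-N*-reduction = begin
      ∑* (λ x → N′ (0# ⊖ a₀ ⊗ x ^ e))  ≡⟨ ∑*-cong (λ x _ → N*-cong n a′ d′ (0-a*x≈x*-a a₀ (x ^ e))) ⟩
      ∑* (λ x → G (x ^ e))             ≡⟨ ∑*-power e (∏ d′) e⊥P G-cong G-invariant ⟩
      ∑* G                             ≡⟨ ∑*-scale (N*-cong n a′ d′) (-x≉0 a₀≉0) ⟩
      ∑* N′                            ∎

  Solution* : (n : ℕ) → Vector Carrier n → Vector ℕ n → Carrier → Vector Carrier n → Set ℓ
  Solution* n a d c x = (∀ j → x j ≉ 0#) × sum (λ j → a j ⊗ x j ^ d j) ≈ c

  solution*? : ∀ n a d c x → Dec (Solution* n a d c x)
  solution*? n a d c x = all? (λ j → ¬? (x j ≟ 0#)) ×-dec (sum (λ j → a j ⊗ x j ^ d j) ≟ c)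

  Solution*-zero : ∀ a d c x → Solution* zero a d c x ⇔ c ≈ 0#
  Solution*-zero a d c x = mk⇔ (𝔽.sym ∘ proj₂) (λ c≈0 → (λ ()) , 𝔽.sym c≈0)

  Solution*-suc : ∀ {n} a d c x → Solution* (suc n) a d c x ⇔
                  (head x ≉ 0# × Solution* n (tail a) (tail d) (c ⊖ head a ⊗ head x ^ head d) (tail x))
  Solution*-suc a d c x = mk⇔
    (λ (x≉0 , ∑≈c) → x≉0 zero , x≉0 ∘ suc , Equivalence.to x+y≈z⇔y≈z-x ∑≈c)
    (λ (x₀≉0 , x′≉0 , ∑′≈) → (λ { zero → x₀≉0 ; (suc j) → x′≉0 j }) ,
                              Equivalence.from x+y≈z⇔y≈z-x ∑′≈)

  count-Solution* : ∀ n a d c (P? : ∀ v → Dec (Solution* n a d c (enum ∘ v))) →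
                    List.sum (map (𝟙 ∘ P?) (tuples size n)) ≡ N* n a d c
  count-Solution* zero    a d c P? = trans (ℕ.+-identityʳ _) (𝟙-cong (Solution*-zero a d c _) (P? _) (c ≟ 0#))
  count-Solution* (suc n) a d c P? = begin
    List.sum (map (𝟙 ∘ P?) (tuples size (suc n)))
      ≡⟨ sum-tuples-suc size n (𝟙 ∘ P?) ⟩
    ∑[ i < size ] List.sum (map (λ v → 𝟙 (P? (i V.∷ v))) (tuples size n))
      ≡⟨ Fin∑.sum-cong-≗ row ⟩
    ∑[ i < size ] ([ enum i ≉0] * N′ (c′ (enum i)))
      ≡⟨ ∑-enum (λ x → [ x ≉0] * N′ (c′ x)) ⟨
    N* (suc n) a d c ∎
    where
    a′ = tail a
    d′ = tail d
    N′ = N* n a′ d′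
    c′ : Carrier → Carrier
    c′ x = c ⊖ head a ⊗ x ^ head d
    Q? : ∀ x v → Dec (Solution* n a′ d′ (c′ x) (enum ∘ v))
    Q? x v = solution*? n a′ d′ (c′ x) (enum ∘ v)
    row : ∀ i → List.sum (map (λ v → 𝟙 (P? (i V.∷ v))) (tuples size n)) ≡ [ enum i ≉0] * N′ (c′ (enum i))
    row i = begin
      List.sum (map (λ v → 𝟙 (P? (i V.∷ v))) (tuples size n))
        ≡⟨ cong List.sum (map-cong split (tuples size n)) ⟩
      List.sum (map (λ v → [ enum i ≉0] * 𝟙 (Q? (enum i) v)) (tuples size n))
        ≡⟨ sum-map-*ˡ [ enum i ≉0] (𝟙 ∘ Q? (enum i)) (tuples size n) ⟩
      [ enum i ≉0] * List.sum (map (𝟙 ∘ Q? (enum i)) (tuples size n))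
        ≡⟨ cong ([ enum i ≉0] *_) (count-Solution* n a′ d′ (c′ (enum i)) (Q? (enum i))) ⟩
      [ enum i ≉0] * N′ (c′ (enum i)) ∎
      where
      split : ∀ v → 𝟙 (P? (i V.∷ v)) ≡ [ enum i ≉0] * 𝟙 (Q? (enum i) v)
      split v = trans (𝟙-cong (Solution*-suc a d c _) (P? (i V.∷ v)) (¬? (enum i ≟ 0#) ×-dec Q? (enum i) v))
                      (𝟙-× (¬? (enum i ≟ 0#)) (Q? (enum i) v))

  N*-diagonal≡N* : ∀ n a d → N*-diagonal F n a d ≡ N* n a d 0#
  N*-diagonal≡N* n a d = trans (length-filter _ (tuples size n)) (count-Solution* n a d 0# _)

open import Data.Nat using (ℕ; _≤_; _∸_)
import Data.Nat as ℕ
open import Data.Nat.Divisibility using (_∣_)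
open import Data.Nat.Coprimality using (Coprime)
open import Data.Integer using (ℤ; +_; -1ℤ; 1ℤ; _+_; _-_; _*_; _^_)
import Data.Integer.Properties as ℤ
open import Data.Integer.Solver using (module +-*-Solver)
open ≡ using (refl; sym; trans; cong; cong₂; module ≡-Reasoning)

pos-^ : ∀ m n → + (m ℕ.^ n) ≡ (+ m) ^ n
pos-^ m ℕ.zero    = refl
pos-^ m (ℕ.suc n) = trans (ℤ.pos-* m (m ℕ.^ n)) (cong (+ m *_) (pos-^ m n))

closed-form-step : ∀ p n {x y} → x + y ≡ p ^ n → (1ℤ + p) * y ≡ p ^ n + -1ℤ ^ n * p →
                   (1ℤ + p) * x ≡ p ^ ℕ.suc n + -1ℤ ^ ℕ.suc n * p
closed-form-step p n {x} {y} x+y≡pⁿ qy≡ = begin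
  (1ℤ + p) * x
    ≡⟨ solve 3 (λ p x y → (con 1ℤ :+ p) :* x := (con 1ℤ :+ p) :* (x :+ y) :- (con 1ℤ :+ p) :* y)
               refl p x y ⟩
  (1ℤ + p) * (x + y) - (1ℤ + p) * y
    ≡⟨ cong₂ (λ u v → (1ℤ + p) * u - v) x+y≡pⁿ qy≡ ⟩
  (1ℤ + p) * p ^ n - (p ^ n + -1ℤ ^ n * p)
    ≡⟨ solve 3 (λ p P s → (con 1ℤ :+ p) :* P :- (P :+ s :* p) := p :* P :+ (con -1ℤ :* s) :* p)
               refl p (p ^ n) (-1ℤ ^ n) ⟩
  p ^ ℕ.suc n + -1ℤ ^ ℕ.suc n * p
    ∎
  where
  open ≡-Reasoning
  open +-*-Solver

module _ {c ℓ : Level} (F : FiniteField c ℓ) where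
  open FiniteField F using (_≉_; 0#; _≟_; size) renaming (refl to ≈-refl)
  open FieldSums F using (suc[size∸1]≡size)
  open DiagonalEquation F
  open Arithmetic
  open Counting using (𝟙-yes)
  open ≡-Reasoning

  N*-closed-form : ∀ n a d → (∀ j → a j ≉ 0#) → (∀ i j → i ≢ j → Coprime (d i) (d j)) →
                   + size * + N* n a d 0# ≡ (+ (size ∸ 1)) ^ n + -1ℤ ^ n * + (size ∸ 1)
  N*-closed-form ℕ.zero a d _ _ = begin
    + size * + N* ℕ.zero a d 0#   ≡⟨ cong (λ m → + size * + m) (𝟙-yes ≈-refl (0# ≟ 0#)) ⟩
    + size * 1ℤ                    ≡⟨ ℤ.*-identityʳ (+ size) ⟩
    + size                         ≡⟨ cong +_ suc[size∸1]≡size ⟨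
    1ℤ + + (size ∸ 1)              ≡⟨ cong (λ m → 1ℤ + m) (ℤ.*-identityˡ (+ (size ∸ 1))) ⟨
    1ℤ + 1ℤ * + (size ∸ 1)         ∎
  N*-closed-form (ℕ.suc n) a d a≉0 d-coprime = begin
    + size * + N* (ℕ.suc n) a d 0#             ≡⟨ cong (_* + N* (ℕ.suc n) a d 0#) size≡1+p ⟩
    (1ℤ + + p) * + N* (ℕ.suc n) a d 0#          ≡⟨ closed-form-step (+ p) n recurrence closed-form′ ⟩
    (+ p) ^ ℕ.suc n + -1ℤ ^ ℕ.suc n * + p      ∎
    where
    p = size ∸ 1
    size≡1+p : + size ≡ 1ℤ + + p
    size≡1+p = cong +_ (sym suc[size∸1]≡size)
    recurrence : + N* (ℕ.suc n) a d 0# + + N* n (tail a) (tail d) 0# ≡ (+ p) ^ n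
    recurrence = trans (cong +_ (N*-recurrence n a d (a≉0 zero) d₀⊥∏d′)) (pos-^ p n)
      where d₀⊥∏d′ = coprime-∏ (tail d) (λ j → d-coprime zero (suc j) λ ())
    closed-form′ : (1ℤ + + p) * + N* n (tail a) (tail d) 0# ≡ (+ p) ^ n + -1ℤ ^ n * + p
    closed-form′ = trans (cong (_* + N* n (tail a) (tail d) 0#) (sym size≡1+p))
                         (N*-closed-form n (tail a) (tail d) (a≉0 ∘ suc)
                           (λ i j i≢j → d-coprime (suc i) (suc j) (i≢j ∘ suc-injective)))

corollary1 : ∀ {c ℓ : Level} (F : FiniteField c ℓ) (n : ℕ) → 2 ≤ n →
    (a : Vector (FiniteField.Carrier F) n) →
    (∀ j → ¬ (FiniteField._≈_ F (a j) (FiniteField.0# F))) →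
    (d : Vector ℕ n) →
    (∀ j → 1 ≤ d j) →
    (∀ j → d j ∣ (FiniteField.size F ∸ 1)) →
    (∀ i j → i ≢ j → Coprime (d i) (d j)) →
    + FiniteField.size F * + N*-diagonal F n a d
      ≡ (+ (FiniteField.size F ∸ 1)) ^ n + (-1ℤ ^ n) * + (FiniteField.size F ∸ 1)
corollary1 F n _ a a≉0 d _ _ d-coprime =
  trans (cong (λ N → + FiniteField.size F * + N) (DiagonalEquation.N*-diagonal≡N* F n a d))
        (N*-closed-form F n a d a≉0 d-coprime)
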